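{- Let $s,k$ be integers with $s<k=o(\log n)$, where $n$ is the input length. Then there is no deterministic algorithm that reads its input $X\in\{0,1\}^n$ variable by variable, uses $s$ bits of memory, and computes $PartialMOD_n^k(X)$ on all inputs in its domain.
   Context: For $X\in\{0,1\}^n$ whose number of ones $\#_1(X)$ equals $v\cdot 2^k$ for an integer $v\ge 2$, $PartialMOD_n^k(X)=v \bmod 2$; the function is defined (partial) only on such inputs. -}

module Defs where

open import Data.Nat using (ℕ; zero; suc; _+_; _*_; _^_; _≤_; _<_)
open import Data.Nat.DivMod using (_%_)
open import Data.Nat.Logarithm using (⌊log₂_⌋)
open import Data.Bool using (Bool; true; false; if_then_else_)
open import Data.Fin using (Fin)
open import Data.List using (foldl; allFin)
open import Data.Product using (∃-syntax; _×_)
open import Function.Definitions using (Injective)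
open import Relation.Binary.PropositionalEquality using (_≡_)

numOnes : (n : ℕ) → (Fin n → Bool) → ℕ
numOnes zero    X = 0
numOnes (suc n) X = (if X Fin.zero then 1 else 0) + numOnes n (λ i → X (Fin.suc i))

-- A deterministic algorithm with s bits of memory (2^s states) reading the
-- n input variables one at a time, in some order (each variable once);
-- the transition may depend on the step number (nonuniform model).
record Algorithm (n s : ℕ) : Set where
  field
    order     : Fin n → Fin n
    order-inj : Injective _≡_ _≡_ order
    start     : Fin (2 ^ s)
    step      : Fin n → Fin (2 ^ s) → Bool → Fin (2 ^ s)
    output    : Fin (2 ^ s) → Bool

finalState : ∀ {n s} → Algorithm n s → (Fin n → Bool) → Fin (2 ^ s)
finalState {n} A X =
  foldl (λ q i → Algorithm.step A i q (X (Algorithm.order A i))) (Algorithm.start A) (allFin n)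

bit : Bool → ℕ
bit true  = 1
bit false = 0

ComputesPartialMOD : ∀ {n s} → (k : ℕ) → Algorithm n s → Set
ComputesPartialMOD {n} k A =
  ∀ (X : Fin n → Bool) (v : ℕ) → 2 ≤ v → numOnes n X ≡ v * 2 ^ k →
  bit (Algorithm.output A (finalState A X)) ≡ v % 2

-- k(n) = o(log n):  for every c ≥ 1, eventually c · k(n) ≤ log₂ n
-- (equivalently c·k(n) ≤ ⌊log₂ n⌋, since the left side is an integer)
LittleOLog : (ℕ → ℕ) → Set
LittleOLog k = ∀ (c : ℕ) → 1 ≤ c → ∃[ N ] (∀ n → N ≤ n → c * k n ≤ ⌊log₂ n ⌋)

module Submission where

-- An algorithm with s bits of memory is a step-indexed automaton with
-- w = 2^s states reading a word y : ℕ → Bool.  Put B = 2^k and M = 2B.  For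
-- each time t and state q we track the residues mod M of the numbers of ones
-- with which q is reachable at time t (Reach).  The input is consumed in
-- epochs of M letters; the block 1^a 0^(M ∸ a) shifts all residues by a.
-- Either some block enlarges the residue set of the current state (this can
-- happen at most M times), or, as w < M, two blocks a < a' lead to the same
-- state; then the residue set is closed under the shift a' ∸ a and, M being a
-- power of two, contains an antipodal pair c, c + B.  Completing the two
-- witnessing prefixes by the same block of ones yields an even and an odd
-- multiple of B ending in the same state, contradicting correctness.  This
-- uses M² + 2M letters, and k = o(log n) gives 2^(5k) ≤ n, which suffices.

open import Defs
open import Data.Nat using (ℕ; _≤_; _<_)
open import Data.Product using (Σ; ∃-syntax)
open import Relation.Nullary using (¬_)

open import Data.Nat
open import Data.Nat.Properties
open import Data.Nat.DivMod
open import Data.Nat.Logarithm using (⌊log₂_⌋; ⌊log₂⌋-mono-≤; ⌊log₂⌊n/2⌋⌋≡⌊log₂n⌋∸1)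
open import Data.Nat.Induction using (<-rec)
open import Data.Nat.Tactic.RingSolver using (solve-∀)
open import Data.Bool using (Bool; true; false; _∧_; _∨_; if_then_else_; T)
open import Data.Bool.Properties using (∨-zeroʳ)
open import Data.Unit using (tt)
open import Data.Fin as F using (Fin; toℕ)
open import Data.Fin.Properties
  using (any?; pigeonhole; punchOut-injective; injective⇒≤; toℕ-injective; toℕ-fromℕ<; toℕ<n)
open import Data.Fin.Permutation using (Permutation; permutation)
open import Data.List using (foldl; tabulate)
open import Data.Product using (∃; ∃₂; _×_; _,_; proj₁; proj₂)
open import Data.Sum using (_⊎_; inj₁; inj₂)
open import Data.Empty using (⊥; ⊥-elim)
open import Function.Definitions using (Injective)
open import Relation.Nullary using (yes; no; does; contradiction)
open import Relation.Binary.PropositionalEquality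
open import Algebra.Properties.CommutativeMonoid.Sum +-0-commutativeMonoid
  using (sum; sum-permute; sum-cong-≗)

2^⌊log₂n⌋≤n : ∀ n → 1 ≤ n → 2 ^ ⌊log₂ n ⌋ ≤ n
2^⌊log₂n⌋≤n = <-rec (λ n → 1 ≤ n → 2 ^ ⌊log₂ n ⌋ ≤ n) go
  where
  twice-half≤ : ∀ n → 2 * ⌊ n /2⌋ ≤ n
  twice-half≤ n = begin
    ⌊ n /2⌋ + (⌊ n /2⌋ + 0) ≡⟨ cong (⌊ n /2⌋ +_) (+-identityʳ _) ⟩
    ⌊ n /2⌋ + ⌊ n /2⌋       ≤⟨ +-monoʳ-≤ ⌊ n /2⌋ (⌊n/2⌋≤⌈n/2⌉ n) ⟩
    ⌊ n /2⌋ + ⌈ n /2⌉       ≡⟨ ⌊n/2⌋+⌈n/2⌉≡n n ⟩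
    n                       ∎
    where open ≤-Reasoning

  go : ∀ n → (∀ {m} → m < n → 1 ≤ m → 2 ^ ⌊log₂ m ⌋ ≤ m) → 1 ≤ n → 2 ^ ⌊log₂ n ⌋ ≤ n
  go (suc zero)        _  _ = ≤-refl
  go n@(suc (suc n-2)) ih _ = begin
    2 ^ ⌊log₂ n ⌋       ≡⟨ cong (2 ^_) log-n ⟩
    2 * 2 ^ ⌊log₂ h ⌋   ≤⟨ *-monoʳ-≤ 2 (ih (⌊n/2⌋<n (suc n-2)) (s≤s z≤n)) ⟩
    2 * h               ≤⟨ twice-half≤ n ⟩
    n                   ∎
    where
    open ≤-Reasoning
    h = ⌊ n /2⌋
    log-n : ⌊log₂ n ⌋ ≡ suc ⌊log₂ h ⌋
    log-n = trans (sym (m+[n∸m]≡n (⌊log₂⌋-mono-≤ {2} {n} (s≤s (s≤s z≤n)))))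
                  (cong suc (sym (⌊log₂⌊n/2⌋⌋≡⌊log₂n⌋∸1 n)))

even-or-odd : ∀ d → ∃ λ h → d ≡ h + h ⊎ d ≡ suc (h + h)
even-or-odd zero = 0 , inj₁ refl
even-or-odd (suc d) with even-or-odd d
... | h , inj₁ d≡2h   = h , inj₂ (cong suc d≡2h)
... | h , inj₂ d≡2h+1 = suc h , inj₁ (trans (cong suc d≡2h+1) (cong suc (sym (+-suc h h))))

-- Modulo 2^(k+1), every 0 < d < 2^(k+1) has a multiple congruent to 2^k:
-- write d = 2^a · u with u odd and a ≤ k; then 2^(k-a) · d ≡ 2^k · u ≡ 2^k.
-- This is why the modulus must be a power of two: a shift by d generates
-- the "antipodal" shift by half the modulus.
multiple-≡-half : ∀ k d → 0 < d → d < 2 ^ k + 2 ^ k →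
                  ∃₂ λ j e → j * d ≡ 2 ^ k + e * (2 ^ k + 2 ^ k)
multiple-≡-half k d 0<d d<2P with even-or-odd d
... | h , inj₂ refl = 2 ^ k , h , odd-case (2 ^ k) h
  where
  odd-case : ∀ P h → P * suc (h + h) ≡ P + h * (P + P)
  odd-case = solve-∀
multiple-≡-half zero d 0<d d<2 | zero , inj₁ refl = ⊥-elim (<-irrefl refl 0<d)
multiple-≡-half zero d 0<d d<2 | suc h , inj₁ refl =
  ⊥-elim (<⇒≱ d<2 (subst (2 ≤_) (cong suc (sym (+-suc h h))) (s≤s (s≤s z≤n))))
multiple-≡-half (suc k) d 0<d d<2P | h , inj₁ refl
  with multiple-≡-half k h (half-pos h 0<d) (half-< (subst (h + h <_) quadruple d<2P))
  where
  half-pos : ∀ h → 0 < h + h → 0 < h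
  half-pos (suc h) _ = s≤s z≤n
  half-< : ∀ {h m} → h + h < m + m → h < m
  half-< lt = ≰⇒> (λ m≤h → <⇒≱ lt (+-mono-≤ m≤h m≤h))
  quadruple : 2 ^ suc k + 2 ^ suc k ≡ (2 ^ k + 2 ^ k) + (2 ^ k + 2 ^ k)
  quadruple = lemma (2 ^ k) where
    lemma : ∀ P → 2 * P + 2 * P ≡ (P + P) + (P + P)
    lemma = solve-∀
... | j , e , jh≡ = j , e , (begin
  j * (h + h)                              ≡⟨ *-distribˡ-+ j h h ⟩
  j * h + j * h                            ≡⟨ cong₂ _+_ jh≡ jh≡ ⟩
  (P + e * (P + P)) + (P + e * (P + P))    ≡⟨ double P e ⟩
  2 * P + e * (2 * P + 2 * P)              ∎)
  where
  open ≡-Reasoning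
  P = 2 ^ k
  double : ∀ P e → (P + e * (P + P)) + (P + e * (P + P)) ≡ 2 * P + e * (2 * P + 2 * P)
  double = solve-∀

%-cong-+ʳ : ∀ n .{{_ : NonZero n}} a b z → a % n ≡ b % n → (a + z) % n ≡ (b + z) % n
%-cong-+ʳ n a b z a≡b = begin
  (a + z) % n               ≡⟨ %-distribˡ-+ a z n ⟩
  (a % n + z % n) % n       ≡⟨ cong (λ u → (u + z % n) % n) a≡b ⟩
  (b % n + z % n) % n       ≡⟨ sym (%-distribˡ-+ b z n) ⟩
  (b + z) % n               ∎
  where open ≡-Reasoning

run : {Q : Set} → (ℕ → Q → Bool → Q) → ℕ → Q → (ℕ → Bool) → ℕ → Q
run δ t q y zero    = q
run δ t q y (suc j) = run δ (suc t) (δ t q (y t)) y j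

ones : ℕ → (ℕ → Bool) → ℕ → ℕ
ones t y zero    = 0
ones t y (suc j) = bit (y t) + ones (suc t) y j

AgreeOn : ℕ → ℕ → (ℕ → Bool) → (ℕ → Bool) → Set
AgreeOn t j y y' = ∀ i → t ≤ i → i < t + j → y i ≡ y' i

private
  agree-head : ∀ {t j y y'} → AgreeOn t (suc j) y y' → y t ≡ y' t
  agree-head {t} {j} ag = ag t ≤-refl (subst (t <_) (sym (+-suc t j)) (s≤s (m≤m+n t j)))

  agree-tail : ∀ {t j y y'} → AgreeOn t (suc j) y y' → AgreeOn (suc t) j y y'
  agree-tail {t} {j} ag i t<i i<t+1+j = ag i (<⇒≤ t<i) (subst (i <_) (sym (+-suc t j)) i<t+1+j)

module _ {Q : Set} (δ : ℕ → Q → Bool → Q) where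

  run-split : ∀ t q y a b → run δ t q y (a + b) ≡ run δ (t + a) (run δ t q y a) y b
  run-split t q y zero    b = cong (λ u → run δ u q y b) (sym (+-identityʳ t))
  run-split t q y (suc a) b = trans (run-split (suc t) (δ t q (y t)) y a b)
    (cong (λ u → run δ u (run δ (suc t) (δ t q (y t)) y a) y b) (sym (+-suc t a)))

  run-cong : ∀ t q y y' j → AgreeOn t j y y' → run δ t q y j ≡ run δ t q y' j
  run-cong t q y y' zero    ag = refl
  run-cong t q y y' (suc j) ag rewrite agree-head {t} {j} {y} {y'} ag =
    run-cong (suc t) (δ t q (y' t)) y y' j (agree-tail {t} {j} ag)

ones-split : ∀ t y a b → ones t y (a + b) ≡ ones t y a + ones (t + a) y b
ones-split t y zero    b = cong (λ u → ones u y b) (sym (+-identityʳ t))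
ones-split t y (suc a) b = trans
  (cong (bit (y t) +_) (trans (ones-split (suc t) y a b)
                              (cong (λ u → ones (suc t) y a + ones u y b) (sym (+-suc t a)))))
  (sym (+-assoc (bit (y t)) _ _))

ones-cong : ∀ t y y' j → AgreeOn t j y y' → ones t y j ≡ ones t y' j
ones-cong t y y' zero    ag = refl
ones-cong t y y' (suc j) ag =
  cong₂ _+_ (cong bit (agree-head {t} {j} ag)) (ones-cong (suc t) y y' j (agree-tail {t} {j} ag))

ones-const-true : ∀ t j → ones t (λ _ → true) j ≡ j
ones-const-true t zero    = refl
ones-const-true t (suc j) = cong suc (ones-const-true (suc t) j)

ones-const-false : ∀ t j → ones t (λ _ → false) j ≡ 0
ones-const-false t zero    = refl
ones-const-false t (suc j) = ones-const-false (suc t) j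

<ᵇ-true : ∀ {i t} → i < t → (i <ᵇ t) ≡ true
<ᵇ-true {i} {t} i<t with i <ᵇ t | <⇒<ᵇ i<t
... | true | _ = refl

<ᵇ-false : ∀ {i t} → t ≤ i → (i <ᵇ t) ≡ false
<ᵇ-false {i} {t} t≤i with i <ᵇ t in eq
... | false = refl
... | true  = ⊥-elim (<⇒≱ (<ᵇ⇒< i t (subst T (sym eq) tt)) t≤i)

onesBelow : ℕ → ℕ → Bool
onesBelow u i = i <ᵇ u

ones-onesBelow : ∀ t a r → ones t (onesBelow (t + a)) (a + r) ≡ a
ones-onesBelow t a r = begin
  ones t w (a + r)                ≡⟨ ones-split t w a r ⟩
  ones t w a + ones (t + a) w r   ≡⟨ cong₂ _+_ front back ⟩
  a + 0                           ≡⟨ +-identityʳ a ⟩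
  a                               ∎
  where
  open ≡-Reasoning
  w = onesBelow (t + a)
  front : ones t w a ≡ a
  front = trans (ones-cong t w _ a (λ i _ i<t+a → <ᵇ-true i<t+a)) (ones-const-true t a)
  back : ones (t + a) w r ≡ 0
  back = trans (ones-cong (t + a) w _ r (λ i t+a≤i _ → <ᵇ-false t+a≤i)) (ones-const-false (t + a) r)

splice : (ℕ → Bool) → ℕ → (ℕ → Bool) → ℕ → Bool
splice p t y i = if i <ᵇ t then p i else y i

splice-prefix : ∀ p t y → AgreeOn 0 t (splice p t y) p
splice-prefix p t y i _ i<t rewrite <ᵇ-true i<t = refl

splice-suffix : ∀ p t y r → AgreeOn t r (splice p t y) y
splice-suffix p t y r i t≤i _ rewrite <ᵇ-false t≤i = refl

module _ {Q : Set} (δ : ℕ → Q → Bool → Q) where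

  run-splice : ∀ q p t y r →
    run δ 0 q (splice p t y) (t + r) ≡ run δ t (run δ 0 q p t) y r
  run-splice q p t y r = begin
    run δ 0 q s (t + r)              ≡⟨ run-split δ 0 q s t r ⟩
    run δ t (run δ 0 q s t) s r      ≡⟨ cong (λ u → run δ t u s r) (run-cong δ 0 q s p t (splice-prefix p t y)) ⟩
    run δ t (run δ 0 q p t) s r      ≡⟨ run-cong δ t _ s y r (splice-suffix p t y r) ⟩
    run δ t (run δ 0 q p t) y r      ∎
    where
    open ≡-Reasoning
    s = splice p t y

ones-splice : ∀ p t y r → ones 0 (splice p t y) (t + r) ≡ ones 0 p t + ones t y r
ones-splice p t y r = begin
  ones 0 s (t + r)          ≡⟨ ones-split 0 s t r ⟩
  ones 0 s t + ones t s r   ≡⟨ cong₂ _+_ (ones-cong 0 s p t (splice-prefix p t y))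
                                         (ones-cong t s y r (splice-suffix p t y r)) ⟩
  ones 0 p t + ones t y r   ∎
  where
  open ≡-Reasoning
  s = splice p t y

ones-append-ones : ∀ p t m r → m ≤ r → ones 0 (splice p t (onesBelow (t + m))) (t + r) ≡ ones 0 p t + m
ones-append-ones p t m r m≤r = begin
  ones 0 (splice p t tail) (t + r)          ≡⟨ ones-splice p t tail r ⟩
  ones 0 p t + ones t tail r                ≡⟨ cong (λ u → ones 0 p t + ones t tail u) (sym (m+[n∸m]≡n m≤r)) ⟩
  ones 0 p t + ones t tail (m + (r ∸ m))    ≡⟨ cong (ones 0 p t +_) (ones-onesBelow t m (r ∸ m)) ⟩
  ones 0 p t + m                            ∎
  where
  open ≡-Reasoning
  tail = onesBelow (t + m)

count : (ℕ → Bool) → ℕ → ℕ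
count f zero    = 0
count f (suc m) = count f m + bit (f m)

private
  bit≤1 : ∀ b → bit b ≤ 1
  bit≤1 true  = ≤-refl
  bit≤1 false = z≤n

  bit-mono : ∀ a b → (a ≡ true → b ≡ true) → bit a ≤ bit b
  bit-mono false b  _   = z≤n
  bit-mono true  b a⇒b rewrite a⇒b refl = ≤-refl

count≤ : ∀ f m → count f m ≤ m
count≤ f zero    = z≤n
count≤ f (suc m) = subst (count f m + bit (f m) ≤_) (+-comm m 1) (+-mono-≤ (count≤ f m) (bit≤1 (f m)))

_⊆_below_ : (ℕ → Bool) → (ℕ → Bool) → ℕ → Set
f ⊆ g below m = ∀ c → c < m → f c ≡ true → g c ≡ true

private
  ⊆-pred : ∀ {f g m} → f ⊆ g below (suc m) → f ⊆ g below m
  ⊆-pred f⊆g c c<m = f⊆g c (≤-trans c<m (n≤1+n _))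

count-mono : ∀ f g m → f ⊆ g below m → count f m ≤ count g m
count-mono f g zero    _   = z≤n
count-mono f g (suc m) f⊆g =
  +-mono-≤ (count-mono f g m (⊆-pred f⊆g)) (bit-mono (f m) (g m) (f⊆g m ≤-refl))

count-strict : ∀ f g m → f ⊆ g below m → ∀ c → c < m → f c ≡ false → g c ≡ true →
               count f m < count g m
count-strict f g (suc m) f⊆g c c<1+m fc gc with c ≟ m
... | yes refl rewrite fc | gc =
  ≤-trans (≤-reflexive (trans (cong suc (+-identityʳ _)) (+-comm 1 (count f c))))
          (+-monoˡ-≤ 1 (count-mono f g c (⊆-pred f⊆g)))
... | no c≢m = +-mono-<-≤ (count-strict f g m (⊆-pred f⊆g) c (≤∧≢⇒< (≤-pred c<1+m) c≢m) fc gc)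
                          (bit-mono (f m) (g m) (f⊆g m ≤-refl))

count-cong : ∀ f g m → (∀ c → f c ≡ g c) → count f m ≡ count g m
count-cong f g zero    f≗g = refl
count-cong f g (suc m) f≗g = cong₂ _+_ (count-cong f g m f≗g) (cong bit (f≗g m))

private
  count-cons : ∀ f m → count f (suc m) ≡ bit (f 0) + count (λ c → f (suc c)) m
  count-cons f zero    = +-comm 0 (bit (f 0))
  count-cons f (suc m) = trans (cong (_+ bit (f (suc m))) (count-cons f m)) (+-assoc (bit (f 0)) _ _)

  count-rotate : ∀ f m → f m ≡ f 0 → count (λ c → f (suc c)) m ≡ count f m
  count-rotate f m fm≡f0 = +-cancelˡ-≡ (bit (f 0)) _ _
    (trans (sym (count-cons f m)) (trans (cong (λ u → count f m + bit u) fm≡f0) (+-comm (count f m) _)))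

count-shift : ∀ f m → (∀ c → f (c + m) ≡ f c) → ∀ a → count (λ c → f (c + a)) m ≡ count f m
count-shift f m periodic zero    = count-cong _ f m (λ c → cong f (+-identityʳ c))
count-shift f m periodic (suc a) = begin
  count (λ c → f (c + suc a)) m   ≡⟨ count-cong _ (λ c → f (suc c + a)) m (λ c → cong f (+-suc c a)) ⟩
  count (λ c → f (suc c + a)) m   ≡⟨ count-rotate (λ c → f (c + a)) m (trans (cong f (+-comm m a)) (periodic a)) ⟩
  count (λ c → f (c + a)) m       ≡⟨ count-shift f m periodic a ⟩
  count f m                       ∎
  where open ≡-Reasoning

anyFin : ∀ {n} → (Fin n → Bool) → Bool
anyFin {zero}  f = false
anyFin {suc n} f = f F.zero ∨ anyFin (λ i → f (F.suc i))

anyFin-intro : ∀ {n} (f : Fin n → Bool) i → f i ≡ true → anyFin f ≡ true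
anyFin-intro f F.zero    fi rewrite fi = refl
anyFin-intro f (F.suc i) fi rewrite anyFin-intro (λ i → f (F.suc i)) i fi = ∨-zeroʳ (f F.zero)

anyFin-elim : ∀ {n} (f : Fin n → Bool) → anyFin f ≡ true → ∃ λ i → f i ≡ true
anyFin-elim {suc n} f any with f F.zero in f0
... | true  = F.zero , f0
... | false with anyFin-elim (λ i → f (F.suc i)) any
...   | i , fi = F.suc i , fi

anyFin-cong : ∀ {n} (f g : Fin n → Bool) → (∀ i → f i ≡ g i) → anyFin f ≡ anyFin g
anyFin-cong {zero}  f g f≗g = refl
anyFin-cong {suc n} f g f≗g = cong₂ _∨_ (f≗g F.zero) (anyFin-cong _ _ (λ i → f≗g (F.suc i)))

_==_ : ∀ {w} → Fin w → Fin w → Bool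
a == b = does (a F.≟ b)

==-refl : ∀ {w} (a : Fin w) → (a == a) ≡ true
==-refl a with a F.≟ a
... | yes _   = refl
... | no a≢a = contradiction refl a≢a

==-sound : ∀ {w} (a b : Fin w) → (a == b) ≡ true → a ≡ b
==-sound a b _ with a F.≟ b
... | yes a≡b = a≡b

∧-elim : ∀ a b → a ∧ b ≡ true → a ≡ true × b ≡ true
∧-elim true true _ = refl , refl

∨-elim : ∀ a b → a ∨ b ≡ true → a ≡ true ⊎ b ≡ true
∨-elim true  b _  = inj₁ refl
∨-elim false b bt = inj₂ bt

-- The modulus M = 2^(k+1) = B + B of the counting argument, written as
-- suc M₁ so that it is syntactically nonzero.
module Modulus (k : ℕ) where

  B : ℕ
  B = 2 ^ k

  M₁ : ℕ
  M₁ = pred (B + B)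

  M : ℕ
  M = suc M₁

  M≡B+B : M ≡ B + B
  M≡B+B = suc-pred (B + B) {{>-nonZero (≤-trans (m^n>0 2 k) (m≤m+n B B))}}

  M≡2^[1+k] : M ≡ 2 ^ suc k
  M≡2^[1+k] = trans M≡B+B (cong (B +_) (sym (+-identityʳ B)))

  B<M : B < M
  B<M = subst (B <_) (sym M≡B+B) (subst (_< B + B) (+-identityʳ B) (+-monoʳ-< B (m^n>0 2 k)))

  HasValue : ℕ → ℕ → Set
  HasValue y b = ∃ λ v → 2 ≤ v × y ≡ v * B × v % 2 ≡ b

  -- Given a count x, completion x = 2M − (x mod M) more ones complete it to a
  -- multiple of M = 2B, i.e. to an EVEN multiple of B.
  completion : ℕ → ℕ
  completion x = (M + M) ∸ x % M

  private
    x+completion≡ : ∀ x → x + completion x ≡ (x / M + 2) * M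
    x+completion≡ x = begin
      x + z                         ≡⟨ cong (_+ z) (m≡m%n+[m/n]*n x M) ⟩
      (x % M + x / M * M) + z       ≡⟨ rearrange (x % M) (x / M * M) z ⟩
      x / M * M + (x % M + z)       ≡⟨ cong (x / M * M +_) (m+[n∸m]≡n (≤-trans (<⇒≤ (m%n<n x M)) (m≤m+n M M))) ⟩
      x / M * M + (M + M)           ≡⟨ collect (x / M) M ⟩
      (x / M + 2) * M               ∎
      where
      open ≡-Reasoning
      z = completion x
      rearrange : ∀ a b c → (a + b) + c ≡ b + (a + c)
      rearrange = solve-∀
      collect : ∀ Q M → Q * M + (M + M) ≡ (Q + 2) * M
      collect = solve-∀

    halves : ∀ v → v * M ≡ (2 * v) * B
    halves v = trans (cong (v *_) M≡B+B) (lemma v B)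
      where
      lemma : ∀ v B → v * (B + B) ≡ (2 * v) * B
      lemma = solve-∀

  completion-even : ∀ x → HasValue (x + completion x) 0
  completion-even x = 2 * Q , *-monoʳ-≤ 2 (≤-trans (s≤s z≤n) (m≤n+m 2 (x / M)))
                    , trans (x+completion≡ x) (halves Q)
                    , trans (cong (_% 2) (*-comm 2 Q)) (m*n%n≡0 Q 2)
    where Q = x / M + 2

  completion-odd : ∀ x x' → x' % M ≡ (x + B) % M → HasValue (x' + completion x) 1
  completion-odd x x' x'≡x+B =
    1 + 2 * Q , s≤s (≤-trans 1≤Q (m≤m+n Q _)) , y≡
    , trans (cong (λ u → (1 + u) % 2) (*-comm 2 Q)) ([m+kn]%n≡m%n 1 Q 2)
    where
    z = completion x
    y = x' + z
    Q = y / M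
    y%M≡B : y % M ≡ B
    y%M≡B = begin
      (x' + z) % M                  ≡⟨ %-cong-+ʳ M x' (x + B) z x'≡x+B ⟩
      (x + B + z) % M               ≡⟨ cong (_% M) (trans (+-assoc x B z) (trans (cong (x +_) (+-comm B z))
                                        (sym (+-assoc x z B)))) ⟩
      (x + z + B) % M               ≡⟨ cong (λ u → (u + B) % M) (x+completion≡ x) ⟩
      ((x / M + 2) * M + B) % M     ≡⟨ cong (_% M) (+-comm _ B) ⟩
      (B + (x / M + 2) * M) % M     ≡⟨ [m+kn]%n≡m%n B (x / M + 2) M ⟩
      B % M                         ≡⟨ m<n⇒m%n≡m B<M ⟩
      B                             ∎
      where open ≡-Reasoning
    M≤y : M ≤ y
    M≤y = ≤-trans (≤-reflexive (sym (m+n∸n≡m M M)))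
                  (≤-trans (∸-monoʳ-≤ (M + M) (<⇒≤ (m%n<n x M))) (m≤n+m z x'))
    1≤Q : 1 ≤ Q
    1≤Q = m≥n⇒m/n>0 M≤y
    y≡ : y ≡ (1 + 2 * Q) * B
    y≡ = begin
      y                   ≡⟨ m≡m%n+[m/n]*n y M ⟩
      y % M + Q * M       ≡⟨ cong₂ _+_ y%M≡B (halves Q) ⟩
      B + (2 * Q) * B     ∎
      where open ≡-Reasoning

module Reachability (k : ℕ) {w : ℕ} (δ : ℕ → Fin w → Bool → Fin w) (q₀ : Fin w) where
  open Modulus k

  -- Reach t q c: some prefix of length t drives q₀ to q with ≡ c (mod M) ones.
  -- This is a decision procedure by forward recursion; reading a 1 moves from
  -- residue c − 1 ≡ c + M₁ to residue c.
  Reach : ℕ → Fin w → ℕ → Bool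
  Reach zero    q  c = (q == q₀) ∧ (c % M ≡ᵇ 0)
  Reach (suc t) q' c = anyFin (λ q → ((δ t q false == q') ∧ Reach t q c)
                                   ∨ ((δ t q true  == q') ∧ Reach t q (c + M₁)))

  Reach-periodic : ∀ t q c → Reach t q (c + M) ≡ Reach t q c
  Reach-periodic zero    q  c = cong (λ r → (q == q₀) ∧ (r ≡ᵇ 0)) ([m+n]%n≡m%n c M)
  Reach-periodic (suc t) q' c = anyFin-cong _ _ λ q →
    cong₂ _∨_ (cong ((δ t q false == q') ∧_) (Reach-periodic t q c))
              (cong ((δ t q true == q') ∧_) (trans (cong (Reach t q) (swap c))
                                                   (Reach-periodic t q (c + M₁))))
    where
    swap : ∀ c → c + M + M₁ ≡ c + M₁ + M
    swap c = trans (+-assoc c M M₁) (trans (cong (c +_) (+-comm M M₁)) (sym (+-assoc c M₁ M)))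

  Reach-+multiple : ∀ t q e c → Reach t q (c + e * M) ≡ Reach t q c
  Reach-+multiple t q zero    c = cong (Reach t q) (+-identityʳ c)
  Reach-+multiple t q (suc e) c = begin
    Reach t q (c + (M + e * M))   ≡⟨ cong (Reach t q) (trans (cong (c +_) (+-comm M (e * M)))
                                                            (sym (+-assoc c (e * M) M))) ⟩
    Reach t q (c + e * M + M)     ≡⟨ Reach-periodic t q (c + e * M) ⟩
    Reach t q (c + e * M)         ≡⟨ Reach-+multiple t q e c ⟩
    Reach t q c                   ∎
    where open ≡-Reasoning

  Reach-mod : ∀ t q c → Reach t q c ≡ Reach t q (c % M)
  Reach-mod t q c = trans (cong (Reach t q) (m≡m%n+[m/n]*n c M)) (Reach-+multiple t q (c / M) (c % M))

  reach-step : ∀ t q c b → Reach t q c ≡ true → Reach (suc t) (δ t q b) (c + bit b) ≡ true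
  reach-step t q c false r = anyFin-intro _ q
    (cong (λ u → u ∨ ((δ t q true == δ t q false) ∧ Reach t q (c + 0 + M₁)))
          (cong₂ _∧_ (==-refl (δ t q false)) (trans (cong (Reach t q) (+-identityʳ c)) r)))
  reach-step t q c true r = anyFin-intro _ q
    (trans (cong (λ u → ((δ t q false == δ t q true) ∧ Reach t q (c + 1)) ∨ u)
                 (cong₂ _∧_ (==-refl (δ t q true))
                            (trans (cong (Reach t q) (+-assoc c 1 M₁)) (trans (Reach-periodic t q c) r))))
           (∨-zeroʳ _))

  reach-run : ∀ t q c y j → Reach t q c ≡ true → Reach (t + j) (run δ t q y j) (c + ones t y j) ≡ true
  reach-run t q c y zero    r = trans (cong₂ (λ u v → Reach u q v) (+-identityʳ t) (+-identityʳ c)) r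
  reach-run t q c y (suc j) r =
    trans (cong₂ (λ u v → Reach u (run δ (suc t) (δ t q (y t)) y j) v) (+-suc t j) (sym (+-assoc c (bit (y t)) _)))
          (reach-run (suc t) (δ t q (y t)) (c + bit (y t)) y j (reach-step t q c (y t) r))

  Witness : ℕ → Fin w → ℕ → Set
  Witness t q c = ∃ λ p → run δ 0 q₀ p t ≡ q × ones 0 p t % M ≡ c % M

  witness-step : ∀ t q c b → Witness t q c → Witness (suc t) (δ t q b) (c + bit b)
  witness-step t q c b (p , run≡q , ones≡c) = p' , run≡ , ones≡
    where
    p' = splice p t (λ _ → b)
    run≡ : run δ 0 q₀ p' (suc t) ≡ δ t q b
    run≡ = trans (cong (run δ 0 q₀ p') (+-comm 1 t))
                 (trans (run-splice δ q₀ p t _ 1) (cong (λ u → δ t u b) run≡q))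
    ones≡ : ones 0 p' (suc t) % M ≡ (c + bit b) % M
    ones≡ = trans (cong (_% M) (trans (cong (ones 0 p') (+-comm 1 t))
                                      (trans (ones-splice p t _ 1) (cong (ones 0 p t +_) (+-identityʳ (bit b))))))
                  (%-cong-+ʳ M (ones 0 p t) c (bit b) ones≡c)

  reach-sound : ∀ t q c → Reach t q c ≡ true → Witness t q c
  reach-sound zero q c r with ∧-elim (q == q₀) _ r
  ... | q≡q₀ , c≡0 = (λ _ → false) , sym (==-sound q q₀ q≡q₀) , sym (≡ᵇ⇒≡ (c % M) 0 (subst T (sym c≡0) tt))
  reach-sound (suc t) q' c r with anyFin-elim _ r
  ... | q , step with ∨-elim _ _ step
  ... | inj₁ zero-step with ∧-elim _ _ zero-step
  ...   | δ≡q' , rq with witness-step t q c false (reach-sound t q c rq)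
  ...     | p , run≡ , ones≡ = p , trans run≡ (==-sound _ _ δ≡q') , trans ones≡ (cong (_% M) (+-identityʳ c))
  reach-sound (suc t) q' c r | q , step | inj₂ one-step with ∧-elim _ _ one-step
  ...   | δ≡q' , rq with witness-step t q (c + M₁) true (reach-sound t q (c + M₁) rq)
  ...     | p , run≡ , ones≡ = p , trans run≡ (==-sound _ _ δ≡q') , trans ones≡ c+M₁+1≡c
    where
    c+M₁+1≡c : (c + M₁ + 1) % M ≡ c % M
    c+M₁+1≡c = trans (cong (_% M) (trans (+-assoc c M₁ 1) (cong (c +_) (+-comm M₁ 1)))) ([m+n]%n≡m%n c M)

  rank : ℕ → Fin w → ℕ
  rank t q = count (Reach t q) M

  block : ℕ → Fin w → ℕ → Fin w
  block t q a = run δ t q (onesBelow (t + a)) M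

  reach-block : ∀ t q a c → a ≤ M → Reach t q c ≡ true → Reach (t + M) (block t q a) (c + a) ≡ true
  reach-block t q a c a≤M r =
    subst (λ u → Reach (t + M) (block t q a) (c + u) ≡ true) block-ones (reach-run t q c (onesBelow (t + a)) M r)
    where
    block-ones : ones t (onesBelow (t + a)) M ≡ a
    block-ones = trans (cong (ones t _) (sym (m+[n∸m]≡n a≤M))) (ones-onesBelow t a (M ∸ a))

  -- If block a does not increase the rank, the shift by a is onto: residue
  -- c + a after the block can only come from residue c before it.
  reach-block⁻¹ : ∀ t q a → a ≤ M → rank (t + M) (block t q a) ≤ rank t q →
                  ∀ c → Reach (t + M) (block t q a) (c + a) ≡ true → Reach t q c ≡ true
  reach-block⁻¹ t q a a≤M no-gain c r =
    trans (Reach-mod t q c) (below (c % M) (m%n<n c M) (trans shifted-mod r))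
    where
    after = Reach (t + M) (block t q a)
    shifted : ℕ → Bool
    shifted c = after (c + a)
    below : ∀ c → c < M → shifted c ≡ true → Reach t q c ≡ true
    below c c<M sc with Reach t q c in rc
    ... | true  = refl
    ... | false = ⊥-elim (<⇒≱
      (count-strict (Reach t q) shifted M (λ c' _ → reach-block t q a c' a≤M) c c<M rc sc)
      (≤-trans (≤-reflexive (count-shift after M (Reach-periodic (t + M) (block t q a)) a)) no-gain))
    shifted-mod : shifted (c % M) ≡ shifted c
    shifted-mod = trans (sym (Reach-+multiple (t + M) (block t q a) (c / M) (c % M + a)))
                        (cong after (trans (+-assoc (c % M) a _)
                          (trans (cong (c % M +_) (+-comm a _))
                            (trans (sym (+-assoc (c % M) _ a)) (cong (_+ a) (sym (m≡m%n+[m/n]*n c M)))))))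

  shift-closed : ∀ t q i j → i < j → j ≤ M → block t q i ≡ block t q j →
                 rank (t + M) (block t q i) ≤ rank t q →
                 ∀ c → Reach t q c ≡ true → Reach t q (c + (j ∸ i)) ≡ true
  shift-closed t q i j i<j j≤M same no-gain c r =
    reach-block⁻¹ t q i (≤-trans (<⇒≤ i<j) j≤M) no-gain (c + (j ∸ i))
      (subst₂ (λ s u → Reach (t + M) s u ≡ true) (sym same) c+j≡ (reach-block t q j c j≤M r))
    where
    c+j≡ : c + j ≡ c + (j ∸ i) + i
    c+j≡ = trans (cong (c +_) (sym (m∸n+n≡m (<⇒≤ i<j)))) (sym (+-assoc c (j ∸ i) i))

  -- Closure under a shift 0 < d < M forces, with each residue c, the
  -- antipodal residue c + B: some multiple of d is ≡ B (mod M).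
  closed⇒antipodal : ∀ t q d → 0 < d → d < M →
                     (∀ c → Reach t q c ≡ true → Reach t q (c + d) ≡ true) →
                     ∀ c → Reach t q c ≡ true → Reach t q (c + B) ≡ true
  closed⇒antipodal t q d 0<d d<M closed c r with multiple-≡-half k d 0<d (subst (d <_) M≡B+B d<M)
  ... | j , e , jd≡ = trans (sym (Reach-+multiple t q e (c + B)))
                            (subst (λ u → Reach t q u ≡ true) c+jd≡ (iterate j c r))
    where
    iterate : ∀ n c → Reach t q c ≡ true → Reach t q (c + n * d) ≡ true
    iterate zero    c r = trans (cong (Reach t q) (+-identityʳ c)) r
    iterate (suc n) c r = trans (cong (Reach t q) (sym (+-assoc c d (n * d)))) (iterate n (c + d) (closed c r))
    c+jd≡ : c + j * d ≡ c + B + e * M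
    c+jd≡ = trans (cong (c +_) (trans jd≡ (cong (λ u → B + e * u) (sym M≡B+B)))) (sym (+-assoc c B (e * M)))

  -- If no block raises the rank and there are fewer states than blocks, two
  -- blocks i < j end in the same state (pigeonhole), so the reachable
  -- residues are closed under j ∸ i and hence under the antipodal shift.
  stuck⇒antipodal : w < M → ∀ t q → (∀ (a : Fin M) → ¬ rank t q < rank (t + M) (block t q (toℕ a))) →
                    ∀ c → Reach t q c ≡ true → Reach t q (c + B) ≡ true
  stuck⇒antipodal w<M t q no-gain with pigeonhole w<M (λ a → block t q (toℕ a))
  ... | i , j , i<j , same = closed⇒antipodal t q (toℕ j ∸ toℕ i) 0<d d<M closed
    where
    0<d : 0 < toℕ j ∸ toℕ i
    0<d = m<n⇒0<n∸m i<j
    d<M : toℕ j ∸ toℕ i < M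
    d<M = ≤-trans (s≤s (m∸n≤m (toℕ j) (toℕ i))) (toℕ<n j)
    closed : ∀ c → Reach t q c ≡ true → Reach t q (c + (toℕ j ∸ toℕ i)) ≡ true
    closed = shift-closed t q (toℕ i) (toℕ j) i<j (<⇒≤ (toℕ<n j)) same (≮⇒≥ (no-gain i))

DecidesPartialMOD : ∀ {w} → ℕ → ℕ → (ℕ → Fin w → Bool → Fin w) → Fin w → (Fin w → Bool) → Set
DecidesPartialMOD k N δ q₀ out =
  ∀ y v → 2 ≤ v → ones 0 y N ≡ v * 2 ^ k → bit (out (run δ 0 q₀ y N)) ≡ v % 2

module Impossibility (k : ℕ) {w : ℕ} (δ : ℕ → Fin w → Bool → Fin w) (q₀ : Fin w)
                     (out : Fin w → Bool) (N : ℕ) (decides : DecidesPartialMOD k N δ q₀ out) where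
  open Modulus k
  open Reachability k δ q₀

  -- Antipodal residues c, c + B at one state, with 2M letters still to come,
  -- are contradictory: appending the same completion 1^m 0^… to both
  -- witnesses gives the same final state, but an even resp. odd multiple of B.
  antipodal-conflict : ∀ t q c → t + (M + M) ≤ N → Witness t q c → Witness t q (c + B) → ⊥
  antipodal-conflict t q c room (p , run-p , ones-p) (p' , run-p' , ones-p') =
    0≢1+n (trans (sym (output-value p 0 (completion-even x)))
                 (trans same-output (output-value p' 1 (completion-odd x x' x'≡x+B))))
    where
    x  = ones 0 p t
    x' = ones 0 p' t
    m  = completion x
    r  = N ∸ t
    t+r≡N : t + r ≡ N
    t+r≡N = m+[n∸m]≡n (≤-trans (m≤m+n t (M + M)) room)
    m≤r : m ≤ r
    m≤r = ≤-trans (m∸n≤m (M + M) (x % M)) (subst (_≤ r) (m+n∸m≡n t (M + M)) (∸-monoˡ-≤ t room))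

    tail = onesBelow (t + m)
    complete : (ℕ → Bool) → ℕ → Bool
    complete p = splice p t tail

    complete-ones : ∀ p → ones 0 (complete p) N ≡ ones 0 p t + m
    complete-ones p = trans (cong (ones 0 (complete p)) (sym t+r≡N)) (ones-append-ones p t m r m≤r)

    complete-run : ∀ p → run δ 0 q₀ (complete p) N ≡ run δ t (run δ 0 q₀ p t) tail r
    complete-run p = trans (cong (run δ 0 q₀ (complete p)) (sym t+r≡N)) (run-splice δ q₀ p t tail r)

    output : (ℕ → Bool) → ℕ
    output p = bit (out (run δ 0 q₀ (complete p) N))

    same-output : output p ≡ output p'
    same-output = cong (λ s → bit (out s))
      (trans (complete-run p) (trans (cong (λ s → run δ t s tail r) (trans run-p (sym run-p')))
                                     (sym (complete-run p'))))

    x'≡x+B : x' % M ≡ (x + B) % M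
    x'≡x+B = trans ones-p' (sym (%-cong-+ʳ M x c B ones-p))

    output-value : ∀ p b → HasValue (ones 0 p t + m) b → output p ≡ b
    output-value p b (v , 2≤v , ≡vB , v%2) = trans (decides (complete p) v 2≤v (trans (complete-ones p) ≡vB)) v%2

  -- At time t, try the M blocks 1^a 0^(M ∸ a), a < M.
  -- If one raises the rank, continue after it; this happens fewer than M
  -- times since rank ≤ M (the fuel bounds the remaining gains).  Otherwise,
  -- as w < M, two blocks end in the same state, so the residues at q are
  -- shift-closed and hence contain an antipodal pair.
  epochs : w < M → ∀ fuel t q c₀ → Reach t q c₀ ≡ true → M ≤ rank t q + fuel →
           t + fuel * M + (M + M) ≤ N → ⊥
  epochs w<M fuel t q c₀ r budget room
    with any? (λ (a : Fin M) → rank t q <? rank (t + M) (block t q (toℕ a)))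
  epochs w<M zero t q c₀ r budget room | yes (a , gain) =
    <⇒≱ gain (≤-trans (count≤ _ M) (≤-trans budget (≤-reflexive (+-identityʳ _))))
  epochs w<M (suc fuel) t q c₀ r budget room | yes (a , gain) =
    epochs w<M fuel (t + M) (block t q (toℕ a)) (c₀ + toℕ a)
      (reach-block t q (toℕ a) c₀ (<⇒≤ (toℕ<n a)) r)
      (≤-trans budget (≤-trans (≤-reflexive (+-suc _ fuel)) (+-monoˡ-≤ fuel gain)))
      (subst (λ u → u + (M + M) ≤ N) (sym (+-assoc t M (fuel * M))) room)
  epochs w<M fuel t q c₀ r budget room | no no-gain =
    antipodal-conflict t q c₀ (≤-trans (+-monoˡ-≤ (M + M) (m≤m+n t (fuel * M))) room)
      (reach-sound t q c₀ r)
      (reach-sound t q (c₀ + B) (stuck⇒antipodal w<M t q (λ a gain → no-gain (a , gain)) c₀ r))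

  -- With M epochs of M letters plus 2M letters for the completion, no
  -- automaton with fewer than M states decides PartialMOD.
  impossible : w < M → M * M + (M + M) ≤ N → ⊥
  impossible w<M room = epochs w<M M 0 q₀ 0 (cong (_∧ true) (==-refl q₀)) (m≤n+m M _) room

no-small-decider : ∀ k {w} N (δ : ℕ → Fin w → Bool → Fin w) q₀ out →
  w < 2 ^ suc k → 2 ^ suc k * 2 ^ suc k + (2 ^ suc k + 2 ^ suc k) ≤ N →
  ¬ DecidesPartialMOD k N δ q₀ out
no-small-decider k {w} N δ q₀ out w<P room decides =
  impossible (subst (w <_) (sym M≡2^[1+k]) w<P) (subst (λ P → P * P + (P + P) ≤ N) (sym M≡2^[1+k]) room)
  where
  open Modulus k
  open Impossibility k δ q₀ out N decides

injective⇒onto : ∀ {n} (f : Fin n → Fin n) → Injective _≡_ _≡_ f → ∀ j → ∃ λ i → f i ≡ j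
injective⇒onto {zero}  f f-inj ()
injective⇒onto {suc n} f f-inj j with any? (λ i → f i F.≟ j)
... | yes hit = hit
... | no miss = ⊥-elim (<-irrefl refl (injective⇒≤ {f = f'} f'-inj))
  where
  j≢f : ∀ i → j ≢ f i
  j≢f i j≡fi = miss (i , sym j≡fi)
  f' : Fin (suc n) → Fin n
  f' i = F.punchOut (j≢f i)
  f'-inj : Injective _≡_ _≡_ f'
  f'-inj {a} {b} e = f-inj (punchOut-injective (j≢f a) (j≢f b) e)

-- The number of ones as a sum, so that it can be permuted.
numOnes-sum : ∀ m (X : Fin m → Bool) → numOnes m X ≡ sum (λ i → bit (X i))
numOnes-sum zero    X = refl
numOnes-sum (suc m) X = cong₂ _+_ (if≡bit (X F.zero)) (numOnes-sum m (λ i → X (F.suc i)))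
  where
  if≡bit : ∀ b → (if b then 1 else 0) ≡ bit b
  if≡bit true  = refl
  if≡bit false = refl

-- An algorithm in the sense of Defs is a step-indexed automaton reading the
-- word y in the order prescribed by `order`: at time t it reads variable
-- order t, which holds the letter y t.
module FromAlgorithm {n s : ℕ} .{{_ : NonZero n}} (A : Algorithm n s) where
  open Algorithm A

  -- Time t as a position of the reading order (t is taken modulo n).
  time : ℕ → Fin n
  time t = F.fromℕ< (m%n<n t n)

  time-toℕ : ∀ {t} → t < n → toℕ (time t) ≡ t
  time-toℕ {t} t<n = trans (toℕ-fromℕ< (m%n<n t n)) (m<n⇒m%n≡m t<n)

  δ : ℕ → Fin (2 ^ s) → Bool → Fin (2 ^ s)
  δ t = step (time t)

  readAt : Fin n → Fin n
  readAt j = proj₁ (injective⇒onto order order-inj j)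

  order-readAt : ∀ j → order (readAt j) ≡ j
  order-readAt j = proj₂ (injective⇒onto order order-inj j)

  readAt-order : ∀ i → readAt (order i) ≡ i
  readAt-order i = order-inj (order-readAt (order i))

  -- The input assignment under which the algorithm reads y 0, y 1, ….
  input : (ℕ → Bool) → Fin n → Bool
  input y j = y (toℕ (readAt j))

  input-order : ∀ y i → input y (order i) ≡ y (toℕ i)
  input-order y i = cong (λ u → y (toℕ u)) (readAt-order i)

  private
    fold-run : ∀ (X : Fin n → Bool) m (f : Fin m → Fin n) t q → (∀ i → toℕ (f i) ≡ t + toℕ i) →
      foldl (λ q i → step i q (X (order i))) q (tabulate f) ≡ run δ t q (λ u → X (order (time u))) m
    fold-run X zero    f t q f≡ = refl
    fold-run X (suc m) f t q f≡ =
      trans (cong (λ i₀ → foldl (λ q i → step i q (X (order i))) (step i₀ q (X (order i₀)))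
                                (tabulate (λ i → f (F.suc i)))) f0≡time)
            (fold-run X m (λ i → f (F.suc i)) (suc t) _ (λ i → trans (f≡ (F.suc i)) (+-suc t (toℕ i))))
      where
      t<n : t < n
      t<n = subst (_< n) (trans (f≡ F.zero) (+-identityʳ t)) (toℕ<n (f F.zero))
      f0≡time : f F.zero ≡ time t
      f0≡time = toℕ-injective (trans (f≡ F.zero) (trans (+-identityʳ t) (sym (time-toℕ t<n))))

  finalState-run : ∀ y → finalState A (input y) ≡ run δ 0 start y n
  finalState-run y = trans (fold-run (input y) n (λ i → i) 0 start (λ i → refl))
    (run-cong δ 0 start _ y n (λ u _ u<n → trans (input-order y (time u)) (cong y (time-toℕ u<n))))

  private
    sum-window : ∀ m t y → sum {m} (λ i → bit (y (t + toℕ i))) ≡ ones t y m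
    sum-window zero    t y = refl
    sum-window (suc m) t y = cong₂ _+_ (cong (λ u → bit (y u)) (+-identityʳ t))
      (trans (sum-cong-≗ {m} (λ i → cong (λ u → bit (y u)) (+-suc t (toℕ i)))) (sum-window m (suc t) y))

  numOnes-input : ∀ y → numOnes n (input y) ≡ ones 0 y n
  numOnes-input y = begin
    numOnes n (input y)                       ≡⟨ numOnes-sum n (input y) ⟩
    sum {n} (λ j → bit (input y j))           ≡⟨ sum-permute (λ j → bit (input y j)) π ⟩
    sum {n} (λ i → bit (input y (order i)))   ≡⟨ sum-cong-≗ {n} (λ i → cong bit (input-order y i)) ⟩
    sum {n} (λ i → bit (y (toℕ i)))           ≡⟨ sum-window n 0 y ⟩
    ones 0 y n                                ∎
    where
    open ≡-Reasoning
    π : Permutation n n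
    π = permutation order readAt order-readAt readAt-order

  decider : ∀ k → ComputesPartialMOD k A → DecidesPartialMOD k n δ start output
  decider k computes y v 2≤v ones≡ =
    subst (λ q → bit (output q) ≡ v % 2) (finalState-run y)
          (computes (input y) v 2≤v (trans (numOnes-input y) ones≡))

-- For k ≥ 1, 5k ≤ ⌊log₂ n⌋ makes n ≥ 2^(5k) ≥ 2^(2k+3) large enough.
room-from-log : ∀ k n → 1 ≤ k → 1 ≤ n → 5 * k ≤ ⌊log₂ n ⌋ →
                2 ^ suc k * 2 ^ suc k + (2 ^ suc k + 2 ^ suc k) ≤ n
room-from-log k@(suc k') n (s≤s z≤n) 1≤n 5k≤log = begin
  P * P + (P + P)              ≤⟨ +-monoʳ-≤ (P * P) P+P≤P*P ⟩
  P * P + P * P                ≡⟨ twice (P * P) ⟩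
  2 * (P * P)                  ≡⟨ cong (2 *_) (sym (^-distribˡ-+-* 2 (suc k) (suc k))) ⟩
  2 ^ suc (suc k + suc k)      ≤⟨ ^-monoʳ-≤ 2 exponent≤ ⟩
  2 ^ (5 * k)                  ≤⟨ ^-monoʳ-≤ 2 5k≤log ⟩
  2 ^ ⌊log₂ n ⌋                ≤⟨ 2^⌊log₂n⌋≤n n 1≤n ⟩
  n                            ∎
  where
  open ≤-Reasoning
  P = 2 ^ suc k
  twice : ∀ x → x + x ≡ 2 * x
  twice x = cong (x +_) (sym (+-identityʳ x))
  P+P≤P*P : P + P ≤ P * P
  P+P≤P*P = subst (_≤ P * P) (sym (twice P)) (*-monoˡ-≤ P (^-monoʳ-≤ 2 {1} {suc k} (s≤s z≤n)))
  exponent≤ : suc (suc k + suc k) ≤ 5 * k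
  exponent≤ = subst (suc (suc k + suc k) ≤_) (sym (split k')) (m≤m+n _ (3 * k'))
    where
    split : ∀ k' → 5 * suc k' ≡ suc (suc (suc k') + suc (suc k')) + 3 * k'
    split = solve-∀

-- The theorem: eventually no algorithm with s(n) < k(n) bits computes
-- PartialMOD_n^k(n), since 2^s(n) < 2^(k(n)+1) and n ≥ 2^(5 k(n)).
lemma1 : (s k : ℕ → ℕ) → (∀ n → s n < k n) → LittleOLog k →
    ∃[ N ] (∀ n → N ≤ n → ¬ (Σ (Algorithm n (s n)) λ A → ComputesPartialMOD (k n) A))
lemma1 s k s<k o-log with o-log 5 (s≤s z≤n)
... | N₀ , large = suc N₀ , no-algorithm
  where
  no-algorithm : ∀ n → suc N₀ ≤ n → ¬ (Σ (Algorithm n (s n)) λ A → ComputesPartialMOD (k n) A)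
  no-algorithm n@(suc n-1) (s≤s N₀≤n-1) (A , computes) =
    no-small-decider (k n) n δ start output fewer-states long-enough (decider (k n) computes)
    where
    open FromAlgorithm A
    open Algorithm A using (start; output)
    fewer-states : 2 ^ s n < 2 ^ suc (k n)
    fewer-states = ^-monoʳ-< 2 (s≤s (s≤s z≤n)) (m<n⇒m<1+n (s<k n))
    long-enough : 2 ^ suc (k n) * 2 ^ suc (k n) + (2 ^ suc (k n) + 2 ^ suc (k n)) ≤ n
    long-enough = room-from-log (k n) n (≤-trans (s≤s z≤n) (s<k n)) (s≤s z≤n) (large n (m≤n⇒m≤1+n N₀≤n-1))
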